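{- Let $n \geq k > t$ be positive integers and let $a \leq n$ be a positive integer. Let $H$ be an $(n,k,t)$-graph having the minimum number of edges among all $(n,k,t)$-graphs with independence number at most $a$. If $\alpha(H) < a$, then $H$ is not an $(n,k-1,t)$-graph.
   Context: A graph $G$ is an $(n,k,t)$-graph if $|V(G)| = n$ and every induced subgraph of $G$ on $k$ vertices contains a clique on $t$ vertices. $\alpha(H)$ denotes the independence number of $H$. -}

module Defs where

open import Data.Nat using (ℕ; _≤_; _<_; _<ᵇ_)
open import Data.Bool using (Bool; true; false; _∧_)
open import Data.Fin using (Fin; toℕ)
open import Data.Fin.Subset using (Subset; _∈_; _⊆_; ∣_∣)
open import Data.List using (List; length; filterᵇ; cartesianProduct; allFin)
open import Data.Product using (Σ; _×_; _,_; ∃)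
open import Relation.Binary.PropositionalEquality using (_≡_; _≢_)

record Graph (n : ℕ) : Set where
  field
    adj   : Fin n → Fin n → Bool
    sym   : ∀ i j → adj i j ≡ adj j i
    irrefl : ∀ i → adj i i ≡ false
open Graph public

edgeCount : ∀ {n} → Graph n → ℕ
edgeCount {n} G =
  length (filterᵇ (λ { (i , j) → adj G i j ∧ (toℕ i <ᵇ toℕ j) })
                  (cartesianProduct (allFin n) (allFin n)))

IsClique : ∀ {n} → Graph n → Subset n → Set
IsClique G S = ∀ i j → i ∈ S → j ∈ S → i ≢ j → adj G i j ≡ true

IsIndependent : ∀ {n} → Graph n → Subset n → Set
IsIndependent G S = ∀ i j → i ∈ S → j ∈ S → i ≢ j → adj G i j ≡ false

IndepAtMost : ∀ {n} → Graph n → ℕ → Set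
IndepAtMost G a = ∀ S → IsIndependent G S → ∣ S ∣ ≤ a

IndepLessThan : ∀ {n} → Graph n → ℕ → Set
IndepLessThan G a = ∀ S → IsIndependent G S → ∣ S ∣ < a

IsNKT : ∀ {n} → Graph n → ℕ → ℕ → Set
IsNKT {n} G k t =
  ∀ (S : Subset n) → ∣ S ∣ ≡ k → Σ (Subset n) λ T → T ⊆ S × ∣ T ∣ ≡ t × IsClique G T

IsEdgeMinimal : ∀ {n} → Graph n → ℕ → ℕ → ℕ → Set
IsEdgeMinimal {n} H k t a =
  IsNKT H k t × IndepAtMost H a ×
  (∀ (G : Graph n) → IsNKT G k t → IndepAtMost G a → edgeCount H ≤ edgeCount G)

{-# OPTIONS --safe #-}
-- Some vertex u of H has a neighbour, since α(H) < a ≤ n.  Deleting all edges at u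
-- gives a graph with fewer edges that is still an (n,k,t)-graph with α ≤ a: a k-set
-- through u contains the (k−1)-set obtained by dropping u, whose t-clique in H avoids u,
-- and an independent set through u loses at most u when passing back to H.  This
-- contradicts the edge-minimality of H.
module Submission where

open import Defs renaming (sym to adj-sym; irrefl to adj-irrefl)
open import Data.Bool as Bool using (Bool; true; false; _∧_; not)
open import Data.Bool.Properties using (∧-comm; ∧-identityʳ; ∧-zeroʳ; T-≡)
open import Data.Fin using (Fin; toℕ; _≟_)
open import Data.Fin.Properties using (any?; toℕ-injective)
open import Data.Fin.Subset using (Subset; _∈_; _∉_; _⊆_; ∣_∣; inside; outside; ⊤; _─_; _-_; ⁅_⁆)
open import Data.Fin.Subset.Properties
  using (_∈?_; ∣⊤∣≡n; p─⊥≡p; p─q⊆p; x∈⁅x⁆)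
open import Data.List using (List; []; _∷_; length; filterᵇ; cartesianProduct; allFin)
open import Data.List.Membership.Propositional using () renaming (_∈_ to _∈ₗ_)
open import Data.List.Membership.Propositional.Properties using (∈-cartesianProduct⁺; ∈-allFin)
open import Data.List.Relation.Unary.Any using (here; there)
open import Data.Nat using (ℕ; suc; _≤_; _<_; _∸_; _<ᵇ_; s≤s)
open import Data.Nat.Properties using (≤-refl; m≤n⇒m≤1+n; <⇒≤; <⇒≱; <-≤-trans; n≮n; <-cmp; <⇒<ᵇ)
open import Data.Product using (∃₂; _×_; _,_)
open import Data.Vec using (_∷_; here; there)
open import Function using (_∘_; Equivalence)
open import Relation.Binary.Definitions using (tri<; tri≈; tri>)
open import Relation.Binary.PropositionalEquality
open import Relation.Nullary using (¬_; yes; no; does; contradiction)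
open import Relation.Nullary.Decidable using (dec-true; dec-false)

private
  variable
    n : ℕ

x∈q⇒x∉p─q : {x : Fin n} {p q : Subset n} → x ∈ q → x ∉ p ─ q
x∈q⇒x∉p─q {p = _ ∷ _} here      ()
x∈q⇒x∉p─q {p = _ ∷ _} (there x∈q) (there x∈p─q) = x∈q⇒x∉p─q x∈q x∈p─q

x∉p-x : (p : Subset n) (x : Fin n) → x ∉ p - x
x∉p-x p x = x∈q⇒x∉p─q (x∈⁅x⁆ x)

x∈p⇒suc∣p-x∣≡∣p∣ : {x : Fin n} {p : Subset n} → x ∈ p → suc ∣ p - x ∣ ≡ ∣ p ∣
x∈p⇒suc∣p-x∣≡∣p∣ {x = Fin.zero}  {inside ∷ p}  here       = cong (suc ∘ ∣_∣) (p─⊥≡p p)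
x∈p⇒suc∣p-x∣≡∣p∣ {x = Fin.suc x} {inside ∷ p}  (there x∈p) = cong suc (x∈p⇒suc∣p-x∣≡∣p∣ x∈p)
x∈p⇒suc∣p-x∣≡∣p∣ {x = Fin.suc x} {outside ∷ p} (there x∈p) = x∈p⇒suc∣p-x∣≡∣p∣ x∈p

module _ {A : Set} {p q : A → Bool} (q⇒p : ∀ x → q x ≡ true → p x ≡ true) where

  length-filterᵇ-mono : (xs : List A) → length (filterᵇ q xs) ≤ length (filterᵇ p xs)
  length-filterᵇ-mono []       = ≤-refl
  length-filterᵇ-mono (x ∷ xs) with q x in qx | p x in px
  ... | true  | true  = s≤s (length-filterᵇ-mono xs)
  ... | true  | false = contradiction (trans (sym (q⇒p x qx)) px) λ ()
  ... | false | true  = m≤n⇒m≤1+n (length-filterᵇ-mono xs)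
  ... | false | false = length-filterᵇ-mono xs

  length-filterᵇ-strict : {y : A} (xs : List A) → y ∈ₗ xs → p y ≡ true → q y ≡ false →
                          length (filterᵇ q xs) < length (filterᵇ p xs)
  length-filterᵇ-strict (x ∷ xs) (here refl) py qy rewrite py | qy = s≤s (length-filterᵇ-mono xs)
  length-filterᵇ-strict (x ∷ xs) (there y∈xs) py qy with q x in qx | p x in px
  ... | true  | true  = s≤s (length-filterᵇ-strict xs y∈xs py qy)
  ... | true  | false = contradiction (trans (sym (q⇒p x qx)) px) λ ()
  ... | false | true  = m≤n⇒m≤1+n (length-filterᵇ-strict xs y∈xs py qy)
  ... | false | false = length-filterᵇ-strict xs y∈xs py qy

_⊆ᴳ_ : Graph n → Graph n → Set
G ⊆ᴳ H = ∀ i j → adj G i j ≡ true → adj H i j ≡ true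

isEdgePair : Graph n → Fin n × Fin n → Bool
isEdgePair G (i , j) = adj G i j ∧ (toℕ i <ᵇ toℕ j)

⊆ᴳ⇒isEdgePair : {G H : Graph n} → G ⊆ᴳ H → ∀ e → isEdgePair G e ≡ true → isEdgePair H e ≡ true
⊆ᴳ⇒isEdgePair {G = G} G⊆H (i , j) e with adj G i j in Gij
... | true rewrite G⊆H i j Gij = e

edgeCount-<-ordered : (G H : Graph n) → G ⊆ᴳ H → (u v : Fin n) → toℕ u < toℕ v →
                      adj H u v ≡ true → adj G u v ≡ false → edgeCount G < edgeCount H
edgeCount-<-ordered G H G⊆H u v u<v Huv Guv =
  length-filterᵇ-strict (⊆ᴳ⇒isEdgePair {G = G} {H} G⊆H) (cartesianProduct (allFin _) (allFin _))
    (∈-cartesianProduct⁺ (∈-allFin u) (∈-allFin v))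
    (cong₂ _∧_ Huv (Equivalence.to T-≡ (<⇒<ᵇ u<v))) (cong (_∧ _) Guv)

edgeCount-< : (G H : Graph n) → G ⊆ᴳ H → (u v : Fin n) →
              adj H u v ≡ true → adj G u v ≡ false → edgeCount G < edgeCount H
edgeCount-< G H G⊆H u v Huv Guv with <-cmp (toℕ u) (toℕ v)
... | tri< u<v _ _ = edgeCount-<-ordered G H G⊆H u v u<v Huv Guv
... | tri≈ _ u≡v _ with refl ← toℕ-injective u≡v = contradiction (trans (sym Huv) (adj-irrefl H u)) λ ()
... | tri> _ _ v<u =
  edgeCount-<-ordered G H G⊆H v u v<u (trans (adj-sym H v u) Huv) (trans (adj-sym G v u) Guv)

record AgreeOutside (u : Fin n) (G H : Graph n) : Set where
  constructor agreeOutside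
  field agree : ∀ i j → i ≢ u → j ≢ u → adj G i j ≡ adj H i j

isolate : Graph n → Fin n → Graph n
isolate H u = record
  { adj    = λ i j → adj H i j ∧ (avoids i ∧ avoids j)
  ; sym    = λ i j → cong₂ _∧_ (adj-sym H i j) (∧-comm (avoids i) (avoids j))
  ; irrefl = λ i → cong (_∧ (avoids i ∧ avoids i)) (adj-irrefl H i)
  }
  where
  avoids : Fin _ → Bool
  avoids i = not (does (i ≟ u))

isolate-⊆ᴳ : (H : Graph n) (u : Fin n) → isolate H u ⊆ᴳ H
isolate-⊆ᴳ H u i j e with adj H i j
... | true = refl

isolate-removes : (H : Graph n) (u v : Fin n) → adj (isolate H u) u v ≡ false
isolate-removes H u v rewrite dec-true (u ≟ u) refl = ∧-zeroʳ (adj H u v)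

isolate-agrees : (H : Graph n) (u : Fin n) → AgreeOutside u (isolate H u) H
isolate-agrees H u = agreeOutside agree
  where
  agree : ∀ i j → i ≢ u → j ≢ u → adj (isolate H u) i j ≡ adj H i j
  agree i j i≢u j≢u rewrite dec-false (i ≟ u) i≢u | dec-false (j ≟ u) j≢u = ∧-identityʳ (adj H i j)

independent-⊆ : {G : Graph n} {S T : Subset n} → IsIndependent G S → T ⊆ S → IsIndependent G T
independent-⊆ ind T⊆S i j i∈T j∈T = ind i j (T⊆S i∈T) (T⊆S j∈T)

module _ {u : Fin n} {G H : Graph n} (G≈H : AgreeOutside u G H) where

  AgreeOutside-on : {S : Subset n} → u ∉ S → ∀ {i j} → i ∈ S → j ∈ S → adj G i j ≡ adj H i j
  AgreeOutside-on u∉S {i} {j} i∈S j∈S =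
    AgreeOutside.agree G≈H i j (λ { refl → u∉S i∈S }) (λ { refl → u∉S j∈S })

  clique-transfer : {T : Subset n} → u ∉ T → IsClique H T → IsClique G T
  clique-transfer u∉T cl i j i∈T j∈T i≢j =
    trans (AgreeOutside-on u∉T i∈T j∈T) (cl i j i∈T j∈T i≢j)

  independent-transfer : {S : Subset n} → u ∉ S → IsIndependent G S → IsIndependent H S
  independent-transfer u∉S ind i j i∈S j∈S i≢j =
    trans (sym (AgreeOutside-on u∉S i∈S j∈S)) (ind i j i∈S j∈S i≢j)

  IsNKT-transfer : {k t : ℕ} → IsNKT H k t → IsNKT H (k ∸ 1) t → IsNKT G k t
  IsNKT-transfer Hk _ S ∣S∣≡k with u ∈? S
  ... | no u∉S =
    let T , T⊆S , ∣T∣≡t , cl = Hk S ∣S∣≡k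
    in  T , T⊆S , ∣T∣≡t , clique-transfer (u∉S ∘ T⊆S) cl
  IsNKT-transfer _ Hk-1 S ∣S∣≡k | yes u∈S =
    let T , T⊆S-u , ∣T∣≡t , cl = Hk-1 (S - u) (cong (_∸ 1) (trans (x∈p⇒suc∣p-x∣≡∣p∣ u∈S) ∣S∣≡k))
    in  T , p─q⊆p S ⁅ u ⁆ ∘ T⊆S-u , ∣T∣≡t , clique-transfer (x∉p-x S u ∘ T⊆S-u) cl

  IndepAtMost-transfer : {a : ℕ} → IndepLessThan H a → IndepAtMost G a
  IndepAtMost-transfer α<a S ind with u ∈? S
  ... | no u∉S  = <⇒≤ (α<a S (independent-transfer u∉S ind))
  ... | yes u∈S = subst (_≤ _) (x∈p⇒suc∣p-x∣≡∣p∣ u∈S)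
    (α<a (S - u) (independent-transfer (x∉p-x S u) (independent-⊆ {G = G} ind (p─q⊆p S ⁅ u ⁆))))

α<n⇒edge : (H : Graph n) → IndepLessThan H n → ∃₂ λ u v → adj H u v ≡ true
α<n⇒edge {n} H α<n with any? (λ u → any? (λ v → adj H u v Bool.≟ true))
... | yes (u , v , Huv) = u , v , Huv
... | no noEdge = contradiction (subst (_< n) (∣⊤∣≡n n) (α<n ⊤ ⊤-independent)) (n≮n n)
  where
  ⊤-independent : IsIndependent H ⊤
  ⊤-independent i j _ _ _ with adj H i j in Hij
  ... | true  = contradiction (i , j , Hij) noEdge
  ... | false = refl

lemma3 : (n k t a : ℕ) → 1 ≤ t → t < k → k ≤ n → 1 ≤ a → a ≤ n →
    (H : Graph n) → IsEdgeMinimal H k t a → IndepLessThan H a →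
    ¬ IsNKT H (k ∸ 1) t
lemma3 n k t a _ _ _ _ a≤n H (Hk , _ , minimal) α<a Hk-1
  with u , v , Huv ← α<n⇒edge H (λ S ind → <-≤-trans (α<a S ind) a≤n) =
  <⇒≱ (edgeCount-< G H (isolate-⊆ᴳ H u) u v Huv (isolate-removes H u v))
      (minimal G (IsNKT-transfer G≈H Hk Hk-1) (IndepAtMost-transfer G≈H α<a))
  where
  G : Graph n
  G = isolate H u
  G≈H : AgreeOutside u G H
  G≈H = isolate-agrees H u
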